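{- Let $G$ be a connected graph. Then $\mu_{\rm t}(G)=1$ if and only if $G$ has at least one bypass vertex and every two distinct bypass vertices $v_1,v_2$ of $G$ satisfy: there exist nonadjacent vertices $u_1,u_2$ with $N_G(u_1)\cap N_G(u_2)=\{v_1,v_2\}$.
   Context: For $X\subseteq V(G)$, two vertices $x,y$ are $X$-visible if there is a shortest $x,y$-path in $G$ with no internal vertex in $X$; $X$ is a total mutual-visibility set if any two vertices of $V(G)$ are $X$-visible, and $\mu_{\rm t}(G)$ is the maximum cardinality of such a set. A vertex $v$ is a bypass vertex if $v$ is not the central vertex of a convex path on three vertices, i.e., there are no two nonadjacent vertices $u,w$ whose only common neighbour is $v$. (A subgraph $H$ is convex if all shortest paths in $G$ between vertices of $H$ lie in $H$.) $N_G(u)$ denotes the neighbourhood of $u$. -}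

module Defs where

open import Data.Nat using (ℕ; zero; suc; _≤_; _<_)
open import Data.Bool using (Bool; true; false)
open import Data.Fin using (Fin; zero; suc; toℕ; fromℕ; inject₁)
open import Data.Fin.Subset using (Subset; _∈_; _∉_; ∣_∣)
open import Data.Product using (Σ; ∃; ∃-syntax; _×_; _,_)
open import Data.Sum using (_⊎_)
open import Relation.Nullary using (¬_)
open import Relation.Binary.PropositionalEquality using (_≡_; _≢_)
open import Function.Bundles using (_⇔_)

record Graph : Set where
  field
    n     : ℕ
    adj   : Fin n → Fin n → Bool
    sym   : ∀ u v → adj u v ≡ adj v u
    irrefl : ∀ u → adj u u ≡ false

open Graph public

V : Graph → Set
V G = Fin (n G)

Adj : (G : Graph) → V G → V G → Set
Adj G u v = adj G u v ≡ true

record Walk (G : Graph) (x y : V G) (k : ℕ) : Set where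
  field
    vtx   : Fin (suc k) → V G
    start : vtx zero ≡ x
    end   : vtx (fromℕ k) ≡ y
    step  : ∀ (i : Fin k) → Adj G (vtx (inject₁ i)) (vtx (suc i))

open Walk public

Connected : Graph → Set
Connected G = ∀ (x y : V G) → ∃[ k ] Walk G x y k

IsShortest : (G : Graph) {x y : V G} {k : ℕ} → Walk G x y k → Set
IsShortest G {x} {y} {k} _ = ∀ (m : ℕ) → Walk G x y m → k ≤ m

InternallyAvoids : (G : Graph) {x y : V G} {k : ℕ} → Walk G x y k → Subset (n G) → Set
InternallyAvoids G {k = k} p X =
  ∀ (j : Fin (suc k)) → 0 < toℕ j → toℕ j < k → vtx p j ∉ X

Visible : (G : Graph) → Subset (n G) → V G → V G → Set
Visible G X x y =
  ∃[ k ] Σ (Walk G x y k) λ p → IsShortest G p × InternallyAvoids G p X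

IsTotalMutualVisibility : (G : Graph) → Subset (n G) → Set
IsTotalMutualVisibility G X = ∀ (x y : V G) → Visible G X x y

μt≡ : Graph → ℕ → Set
μt≡ G m =
  (∃[ X ] (IsTotalMutualVisibility G X × ∣ X ∣ ≡ m))
  × (∀ X → IsTotalMutualVisibility G X → ∣ X ∣ ≤ m)

IsBypass : (G : Graph) → V G → Set
IsBypass G v =
  ¬ (∃[ u ] ∃[ w ] (u ≢ w × ¬ Adj G u w ×
      (∀ z → (Adj G u z × Adj G w z) ⇔ (z ≡ v))))

CommonPairWitness : (G : Graph) → V G → V G → Set
CommonPairWitness G v₁ v₂ =
  ∃[ u₁ ] ∃[ u₂ ] (u₁ ≢ u₂ × ¬ Adj G u₁ u₂ ×
    (∀ z → (Adj G u₁ z × Adj G u₂ z) ⇔ (z ≡ v₁ ⊎ z ≡ v₂)))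

-- Call a pair u, w of distinct nonadjacent vertices with a common neighbour
-- X-blocked if all common neighbours of u and w lie in X.  A set X is a total
-- mutual-visibility set exactly when it blocks no pair: a geodesic between a
-- blocked pair must pass through a common neighbour, and conversely any geodesic
-- can be cleaned up vertex by vertex, since its first two edges form a geodesic of
-- length two whose middle vertex may be replaced by a common neighbour outside X.
-- A vertex v is a bypass vertex iff the singleton {v} blocks no pair, so the
-- members of a total mutual-visibility set are bypass vertices, and {v} itself is
-- such a set.  Two distinct bypass vertices v₁, v₂ fit into a common total
-- mutual-visibility set iff {v₁, v₂} blocks no pair; a pair blocked by {v₁, v₂}
-- has common neighbourhood exactly {v₁, v₂}, as a smaller one would violate the
-- bypass property of v₁ or v₂.

module Submission where

open import Defs hiding (sym)
open import Data.Bool using (true)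
open import Data.Bool.Properties using () renaming (_≟_ to _≟ᵇ_)
open import Data.Empty using (⊥-elim)
open import Data.Fin using (Fin; zero; suc; toℕ; _≟_)
open import Data.Fin.Properties using (any?; all?)
open import Data.Fin.Subset using (Subset; _∈_; _∉_; ∣_∣; ⁅_⁆; _∪_; Nonempty; Empty)
open import Data.Fin.Subset.Properties
  using (_∈?_; nonempty?; Empty-unique; ∣⊥∣≡0; ∣⁅x⁆∣≡1; x∈⁅x⁆; x∈⁅y⁆⇒x≡y
        ; p⊆q⇒∣p∣≤∣q∣; p⊂q⇒∣p∣<∣q∣; x∈p∪q⁺; x∈p∪q⁻)
open import Data.Nat using (ℕ; zero; suc; _≤_; _<_; z≤n; s≤s; s≤s⁻¹)
open import Data.Nat.Induction using (<-wellFounded)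
open import Data.Nat.Properties using (anyUpTo?; ≮⇒≥; <⇒≱; 1+n≰n; n≤1+n; ≤-trans; ≤-refl)
open import Data.Product using (_×_; _,_; Σ; ∃-syntax)
open import Data.Sum as Sum using (_⊎_; inj₁; inj₂; [_,_]; swap)
open import Data.Unit using (⊤)
open import Function using (_∘_; id)
open import Function.Bundles using (_⇔_; mk⇔; Equivalence)
open import Induction.WellFounded using (Acc; acc)
open import Relation.Binary.PropositionalEquality using (_≡_; _≢_; refl; sym; trans; cong; subst)
open import Relation.Nullary using (¬_; Dec; yes; no; ¬?)
open import Relation.Nullary.Decidable using (_×-dec_; _→-dec_; map′; decidable-stable)
open import Relation.Unary using (Pred; Decidable)

open Equivalence

least-satisfier : ∀ {p} {P : Pred ℕ p} → Decidable P →
  ∀ {k} → P k → ∃[ m ] (P m × (∀ {j} → P j → m ≤ j))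
least-satisfier {P = P} P? {k} = go (<-wellFounded k)
  where
  go : ∀ {k} → Acc _<_ k → P k → ∃[ m ] (P m × (∀ {j} → P j → m ≤ j))
  go {k} (acc smaller) Pk with anyUpTo? P? k
  ... | yes (m , m<k , Pm) = go (smaller m<k) Pm
  ... | no none = k , Pk , λ Pj → ≮⇒≥ (λ j<k → none (_ , j<k , Pj))

Empty⇒∣p∣≡0 : ∀ {n} {p : Subset n} → Empty p → ∣ p ∣ ≡ 0
Empty⇒∣p∣≡0 {n} p-empty = trans (cong ∣_∣ (Empty-unique p-empty)) (∣⊥∣≡0 n)

∣p∣≡1⇒Nonempty : ∀ {n} {p : Subset n} → ∣ p ∣ ≡ 1 → Nonempty p
∣p∣≡1⇒Nonempty {p = p} ∣p∣≡1 with nonempty? p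
... | yes p-nonempty = p-nonempty
... | no p-empty with () ← trans (sym (Empty⇒∣p∣≡0 p-empty)) ∣p∣≡1

subsingleton⇒∣p∣≤1 : ∀ {n} {p : Subset n} → (∀ {x y} → x ∈ p → y ∈ p → x ≡ y) → ∣ p ∣ ≤ 1
subsingleton⇒∣p∣≤1 {p = p} unique with nonempty? p
... | yes (x , x∈p) = subst (∣ p ∣ ≤_) (∣⁅x⁆∣≡1 x)
  (p⊆q⇒∣p∣≤∣q∣ (λ y∈p → subst (_∈ ⁅ x ⁆) (unique x∈p y∈p) (x∈⁅x⁆ x)))
... | no p-empty = subst (_≤ 1) (sym (Empty⇒∣p∣≡0 p-empty)) z≤n

∣p∣≤1⇒subsingleton : ∀ {n} {p : Subset n} → ∣ p ∣ ≤ 1 → ∀ {x y} → x ∈ p → y ∈ p → x ≡ y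
∣p∣≤1⇒subsingleton {p = p} ∣p∣≤1 {x} {y} x∈p y∈p = decidable-stable (x ≟ y) λ x≢y →
  <⇒≱ (subst (_< ∣ p ∣) (∣⁅x⁆∣≡1 x) (p⊂q⇒∣p∣<∣q∣ (⁅x⁆⊆p , y , y∈p , x≢y ∘ sym ∘ x∈⁅y⁆⇒x≡y x))) ∣p∣≤1
  where
  ⁅x⁆⊆p : ∀ {z} → z ∈ ⁅ x ⁆ → z ∈ p
  ⁅x⁆⊆p z∈⁅x⁆ = subst (_∈ p) (sym (x∈⁅y⁆⇒x≡y x z∈⁅x⁆)) x∈p

module _ (G : Graph) where

  adj-sym : ∀ {u v} → Adj G u v → Adj G v u
  adj-sym {u} {v} = trans (Graph.sym G v u)

  adj? : ∀ u v → Dec (Adj G u v)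
  adj? u v = adj G u v ≟ᵇ true

  CommonNeighbour : V G → V G → V G → Set
  CommonNeighbour u w z = Adj G u z × Adj G w z

  common? : ∀ u w z → Dec (CommonNeighbour u w z)
  common? u w z = adj? u z ×-dec adj? w z

  infix 4 _⇝[_]_
  infixr 5 _∷_

  data _⇝[_]_ : V G → ℕ → V G → Set where
    []  : ∀ {x} → x ⇝[ 0 ] x
    _∷_ : ∀ {x z y k} → Adj G x z → z ⇝[ k ] y → x ⇝[ suc k ] y

  walk? : ∀ k x y → Dec (x ⇝[ k ] y)
  walk? zero x y = map′ (λ { refl → [] }) (λ { [] → refl }) (x ≟ y)
  walk? (suc k) x y = map′ (λ { (_ , a , p) → a ∷ p }) (λ { (a ∷ p) → _ , a , p })
    (any? λ z → adj? x z ×-dec walk? k z y)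

  walk-tail : ∀ {x y k} (p : Walk G x y (suc k)) → Walk G (vtx p (suc zero)) y k
  walk-tail p = record { vtx = vtx p ∘ suc ; start = refl ; end = end p ; step = step p ∘ suc }

  fromWalk : ∀ {x y k} → Walk G x y k → x ⇝[ k ] y
  fromWalk {k = zero} p with refl ← trans (sym (start p)) (end p) = []
  fromWalk {k = suc k} p = subst (λ u → Adj G u _) (start p) (step p zero) ∷ fromWalk (walk-tail p)

  toWalk : ∀ {x y k} → x ⇝[ k ] y → Walk G x y k
  toWalk {x} [] = record { vtx = λ _ → x ; start = refl ; end = refl ; step = λ () }
  toWalk {x} (a ∷ p) = record
    { vtx   = λ { zero → x ; (suc i) → vtx q i }
    ; start = refl
    ; end   = end q
    ; step  = λ { zero → subst (Adj G x) (sym (start q)) a ; (suc i) → step q i }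
    }
    where q = toWalk p

  NoShorterWalk : V G → V G → ℕ → Set
  NoShorterWalk x y k = ∀ {m} → x ⇝[ m ] y → k ≤ m

  shortest-walk : Connected G → ∀ x y → ∃[ k ] (x ⇝[ k ] y × NoShorterWalk x y k)
  shortest-walk connected x y with _ , p ← connected x y =
    least-satisfier (λ k → walk? k x y) (fromWalk p)

  tail-shortest : ∀ {x z y k} → Adj G x z → NoShorterWalk x y (suc k) → NoShorterWalk z y k
  tail-shortest a shortest q = s≤s⁻¹ (shortest (a ∷ q))

  shortcut-distinct : ∀ {x z y m} → NoShorterWalk x y (suc (suc m)) → z ⇝[ m ] y → x ≢ z
  shortcut-distinct shortest q refl = 1+n≰n (≤-trans (n≤1+n _) (shortest q))

  shortcut-nonadjacent : ∀ {x z y m} → NoShorterWalk x y (suc (suc m)) → z ⇝[ m ] y → ¬ Adj G x z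
  shortcut-nonadjacent shortest q a = 1+n≰n (shortest (a ∷ q))

  AvoidsInit : ∀ {x y k} → Subset (n G) → x ⇝[ k ] y → Set
  AvoidsInit X [] = ⊤
  AvoidsInit X (_∷_ {x} _ p) = x ∉ X × AvoidsInit X p

  AvoidsInterior : ∀ {x y k} → Subset (n G) → x ⇝[ k ] y → Set
  AvoidsInterior X [] = ⊤
  AvoidsInterior X (_ ∷ p) = AvoidsInit X p

  toWalk-avoidsInit : ∀ {X x y k} (p : x ⇝[ k ] y) → AvoidsInit X p →
    ∀ (j : Fin (suc k)) → toℕ j < k → vtx (toWalk p) j ∉ X
  toWalk-avoidsInit (_ ∷ p) (x∉X , _) zero _ = x∉X
  toWalk-avoidsInit (_ ∷ p) (_ , p-avoids) (suc j) j<k = toWalk-avoidsInit p p-avoids j (s≤s⁻¹ j<k)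

  toWalk-avoidsInterior : ∀ {X x y k} (p : x ⇝[ k ] y) → AvoidsInterior X p →
    InternallyAvoids G (toWalk p) X
  toWalk-avoidsInterior (_ ∷ p) p-avoids (suc j) _ j<k = toWalk-avoidsInit p p-avoids j (s≤s⁻¹ j<k)

  shortest-avoiding⇒visible : ∀ {X x y k} (p : x ⇝[ k ] y) → NoShorterWalk x y k →
    AvoidsInterior X p → Visible G X x y
  shortest-avoiding⇒visible {k = k} p shortest p-avoids =
    k , toWalk p , (λ _ q → shortest (fromWalk q)) , toWalk-avoidsInterior p p-avoids

  Blocks : Subset (n G) → V G → V G → Set
  Blocks X u w = u ≢ w × ¬ Adj G u w × (∃[ m ] CommonNeighbour u w m)
    × (∀ z → CommonNeighbour u w z → z ∈ X)

  blocks? : ∀ X u w → Dec (Blocks X u w)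
  blocks? X u w = ¬? (u ≟ w) ×-dec ¬? (adj? u w) ×-dec any? (common? u w)
    ×-dec all? (λ z → common? u w z →-dec z ∈? X)

  Unblocked : Subset (n G) → Set
  Unblocked X = ∀ u w → ¬ Blocks X u w

  unblocked⇒common-outside : ∀ {X u w m} → Unblocked X → u ≢ w → ¬ Adj G u w →
    CommonNeighbour u w m → ∃[ c ] (c ∉ X × CommonNeighbour u w c)
  unblocked⇒common-outside {X} {u} {w} {m} unblocked u≢w ¬uw common-m
    with any? (λ c → ¬? (c ∈? X) ×-dec common? u w c)
  ... | yes found = found
  ... | no none = ⊥-elim (unblocked u w (u≢w , ¬uw , (m , common-m) , all-in-X))
    where
    all-in-X : ∀ z → CommonNeighbour u w z → z ∈ X
    all-in-X z common-z = decidable-stable (z ∈? X) (λ z∉X → none (z , z∉X , common-z))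

  reroute : ∀ {X x y k} → Unblocked X → (p : x ⇝[ k ] y) → NoShorterWalk x y k →
    Σ (x ⇝[ k ] y) (AvoidsInterior X)
  reroute unblocked [] _ = [] , _
  reroute unblocked (a ∷ []) _ = a ∷ [] , _
  reroute unblocked (a ∷ p@(_ ∷ _)) shortest
    with b ∷ q , q-avoids ← reroute unblocked p (tail-shortest a shortest)
    with c , c∉X , xc , z′c ← unblocked⇒common-outside unblocked
           (shortcut-distinct shortest q) (shortcut-nonadjacent shortest q) (a , adj-sym b)
    = xc ∷ adj-sym z′c ∷ q , c∉X , q-avoids

  unblocked⇒tmv : ∀ {X} → Connected G → Unblocked X → IsTotalMutualVisibility G X
  unblocked⇒tmv connected unblocked x y
    with _ , p , shortest ← shortest-walk connected x y
    with p′ , p′-avoids ← reroute unblocked p shortest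
    = shortest-avoiding⇒visible p′ shortest p′-avoids

  walk-middle-common : ∀ {u w} (p : Walk G u w 2) → CommonNeighbour u w (vtx p (suc zero))
  walk-middle-common p = subst (λ v → Adj G v _) (start p) (step p zero)
                       , adj-sym (subst (Adj G _) (end p) (step p (suc zero)))

  tmv⇒unblocked : ∀ {X} → IsTotalMutualVisibility G X → Unblocked X
  tmv⇒unblocked tmv u w (u≢w , ¬uw , (_ , um , wm) , all-in-X) with tmv u w
  ... | 0 , p , _ , _ with [] ← fromWalk p = u≢w refl
  ... | 1 , p , _ , _ with a ∷ [] ← fromWalk p = ¬uw a
  ... | 2 , p , _ , p-avoids =
    p-avoids (suc zero) (s≤s z≤n) ≤-refl (all-in-X _ (walk-middle-common p))
  ... | suc (suc (suc _)) , _ , shortest , _ =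
    <⇒≱ (s≤s (s≤s (s≤s z≤n))) (shortest 2 (toWalk (um ∷ adj-sym wm ∷ [])))

  tmv⊎blocked : Connected G → ∀ X → IsTotalMutualVisibility G X ⊎ ∃[ u ] ∃[ w ] Blocks X u w
  tmv⊎blocked connected X with any? (λ u → any? (λ w → blocks? X u w))
  ... | yes blocked = inj₂ blocked
  ... | no none = inj₁ (unblocked⇒tmv connected λ u w blocks → none (u , w , blocks))

  uniqueCommon⇒¬bypass : ∀ {u w m v} → u ≢ w → ¬ Adj G u w → CommonNeighbour u w m →
    (∀ z → CommonNeighbour u w z → z ≡ v) → ¬ IsBypass G v
  uniqueCommon⇒¬bypass {u} {w} {m} u≢w ¬uw common-m only bypass =
    bypass (u , w , u≢w , ¬uw , λ z →
      mk⇔ (only z) λ { refl → subst (CommonNeighbour u w) (only m common-m) common-m })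

  bypass⇒unblocked-⁅⁆ : ∀ {v} → IsBypass G v → Unblocked ⁅ v ⁆
  bypass⇒unblocked-⁅⁆ {v} bypass _ _ (u≢w , ¬uw , (_ , common-m) , all-in-⁅v⁆) =
    uniqueCommon⇒¬bypass u≢w ¬uw common-m (λ z → x∈⁅y⁆⇒x≡y v ∘ all-in-⁅v⁆ z) bypass

  tmv⇒bypass : ∀ {X v} → IsTotalMutualVisibility G X → v ∈ X → IsBypass G v
  tmv⇒bypass {X} tmv v∈X (u , w , u≢w , ¬uw , common⇔v) =
    tmv⇒unblocked tmv u w (u≢w , ¬uw , (_ , from (common⇔v _) refl) , λ z common-z →
      subst (_∈ X) (sym (to (common⇔v z) common-z)) v∈X)

  bypass-common : ∀ {u w m v₁ v₂} → IsBypass G v₁ → IsBypass G v₂ → u ≢ w → ¬ Adj G u w →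
    CommonNeighbour u w m → (∀ z → CommonNeighbour u w z → z ≡ v₁ ⊎ z ≡ v₂) →
    CommonNeighbour u w v₁
  bypass-common {u} {w} {v₁ = v₁} _ bypass₂ u≢w ¬uw common-m among with common? u w v₁
  ... | yes common-v₁ = common-v₁
  ... | no ¬common-v₁ = ⊥-elim (uniqueCommon⇒¬bypass u≢w ¬uw common-m only-v₂ bypass₂)
    where
    only-v₂ : ∀ z → CommonNeighbour u w z → z ≡ _
    only-v₂ z common-z =
      [ (λ { refl → ⊥-elim (¬common-v₁ common-z) }) , id ] (among z common-z)

  blocks-pair⇒witness : ∀ {u w v₁ v₂} → IsBypass G v₁ → IsBypass G v₂ →
    Blocks (⁅ v₁ ⁆ ∪ ⁅ v₂ ⁆) u w → CommonPairWitness G v₁ v₂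
  blocks-pair⇒witness {u} {w} {v₁} {v₂} bypass₁ bypass₂ (u≢w , ¬uw , (_ , common-m) , all-in-pair) =
    u , w , u≢w , ¬uw , λ z → mk⇔ (among z)
      [ (λ { refl → bypass-common bypass₁ bypass₂ u≢w ¬uw common-m among })
      , (λ { refl → bypass-common bypass₂ bypass₁ u≢w ¬uw common-m (λ z → swap ∘ among z) })
      ]
    where
    among : ∀ z → CommonNeighbour u w z → z ≡ v₁ ⊎ z ≡ v₂
    among z = Sum.map (x∈⁅y⁆⇒x≡y v₁) (x∈⁅y⁆⇒x≡y v₂) ∘ x∈p∪q⁻ ⁅ v₁ ⁆ ⁅ v₂ ⁆ ∘ all-in-pair z

  witness⇒blocks : ∀ {X v₁ v₂} → CommonPairWitness G v₁ v₂ → v₁ ∈ X → v₂ ∈ X →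
    ∃[ u ] ∃[ w ] Blocks X u w
  witness⇒blocks {X} (u , w , u≢w , ¬uw , common⇔pair) v₁∈X v₂∈X =
    u , w , u≢w , ¬uw , (_ , from (common⇔pair _) (inj₁ refl)) , λ z common-z →
      [ (λ { refl → v₁∈X }) , (λ { refl → v₂∈X }) ] (to (common⇔pair z) common-z)

theorem5p3 : (G : Graph) → Connected G →
    μt≡ G 1 ⇔
      ((∃[ v ] IsBypass G v) ×
       (∀ v₁ v₂ → v₁ ≢ v₂ → IsBypass G v₁ → IsBypass G v₂ → CommonPairWitness G v₁ v₂))
theorem5p3 G connected = mk⇔ forward backward
  where
  BypassPairsWitnessed : Set
  BypassPairsWitnessed =
    ∀ v₁ v₂ → v₁ ≢ v₂ → IsBypass G v₁ → IsBypass G v₂ → CommonPairWitness G v₁ v₂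

  forward : μt≡ G 1 → (∃[ v ] IsBypass G v) × BypassPairsWitnessed
  forward ((X , tmv , ∣X∣≡1) , maximum) = bypass-exists , pairs
    where
    bypass-exists : ∃[ v ] IsBypass G v
    bypass-exists with v , v∈X ← ∣p∣≡1⇒Nonempty ∣X∣≡1 = v , tmv⇒bypass G tmv v∈X

    pairs : BypassPairsWitnessed
    pairs v₁ v₂ v₁≢v₂ bypass₁ bypass₂ with tmv⊎blocked G connected (⁅ v₁ ⁆ ∪ ⁅ v₂ ⁆)
    ... | inj₁ tmv-pair = ⊥-elim (v₁≢v₂ (∣p∣≤1⇒subsingleton (maximum _ tmv-pair)
            (x∈p∪q⁺ (inj₁ (x∈⁅x⁆ v₁))) (x∈p∪q⁺ (inj₂ (x∈⁅x⁆ v₂)))))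
    ... | inj₂ (_ , _ , blocks) = blocks-pair⇒witness G bypass₁ bypass₂ blocks

  backward : (∃[ v ] IsBypass G v) × BypassPairsWitnessed → μt≡ G 1
  backward ((v , bypass) , pairs) =
    (⁅ v ⁆ , unblocked⇒tmv G connected (bypass⇒unblocked-⁅⁆ G bypass) , ∣⁅x⁆∣≡1 v) ,
    λ X tmv → subsingleton⇒∣p∣≤1 (members-equal tmv)
    where
    members-equal : ∀ {X} → IsTotalMutualVisibility G X → ∀ {v₁ v₂} → v₁ ∈ X → v₂ ∈ X → v₁ ≡ v₂
    members-equal tmv {v₁} {v₂} v₁∈X v₂∈X = decidable-stable (v₁ ≟ v₂) λ v₁≢v₂ →
      let witness = pairs v₁ v₂ v₁≢v₂ (tmv⇒bypass G tmv v₁∈X) (tmv⇒bypass G tmv v₂∈X)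
          u , w , blocks = witness⇒blocks G witness v₁∈X v₂∈X
      in tmv⇒unblocked G tmv u w blocks
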